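{- Let $G$ be a circle graph given by a chord representation, with vertices $s,t$. Then every chord $v$ that is an internal vertex of some $s$–$t$ shortest path has a unique orientation: all $s$–$t$ shortest paths through $v$ induce the same orientation on the chord $v$.
   Context: A circle graph is a graph whose vertices can be represented by chords of a circle so that two vertices are adjacent iff their chords intersect; vertices are identified with chords. For an $s$–$t$ shortest path through a chord $v$ with $d(s,v)=i$, $0<i<d(s,t)$, whose predecessor on the path is $a$ (with $d(s,a)=i-1$) and successor is $b$ (with $d(s,b)=i+1$), this path induces on $v$ the orientation from the point where $a$ crosses $v$ to the point where $b$ crosses $v$. -}

module Defs where

open import Data.Nat using (ℕ; zero; suc; _<_; _≤_; _<ᵇ_)
open import Data.Fin using (Fin)
open import Data.Product using (_×_; Σ; ∃)
open import Data.Sum using (_⊎_)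
open import Data.Bool using (if_then_else_)
open import Relation.Nullary using (¬_; yes; no)
open import Relation.Binary.PropositionalEquality using (_≡_; _≢_)
open import Data.Nat using (_<?_)

-- Points on the circle are encoded by natural
-- numbers; the cyclic order of points is the order of ℕ (the circle is
-- cut open at some point that is not an endpoint).
record Chord : Set where
  constructor chord
  field
    left  : ℕ
    right : ℕ
    left<right : left < right
open Chord public

record ChordRep (n : ℕ) : Set where
  field
    chords   : Fin n → Chord
    distinct : ∀ u v → u ≢ v →
      (left (chords u) ≢ left (chords v)) ×
      (left (chords u) ≢ right (chords v)) ×
      (right (chords u) ≢ right (chords v))
open ChordRep public

-- two chords intersect iff their endpoints interleave
Crosses : Chord → Chord → Set
Crosses c d =
  (left c < left d × left d < right c × right c < right d) ⊎
  (left d < left c × left c < right d × right d < right c)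

Adj : ∀ {n} → ChordRep n → Fin n → Fin n → Set
Adj G u v = Crosses (chords G u) (chords G v)

-- P is an s–t walk of length k: vertices P 0, …, P k (values of P
-- beyond k are irrelevant).
IsWalk : ∀ {n} → ChordRep n → Fin n → Fin n → ℕ → (ℕ → Fin n) → Set
IsWalk G s t k P = (P 0 ≡ s) × (P k ≡ t) × (∀ j → j < k → Adj G (P j) (P (suc j)))

Dist : ∀ {n} → ChordRep n → Fin n → Fin n → ℕ → Set
Dist {n} G s t d = (Σ (ℕ → Fin n) λ P → IsWalk G s t d P) ×
               (∀ k P → IsWalk G s t k P → d ≤ k)

IsShortestPath : ∀ {n} → ChordRep n → Fin n → Fin n → ℕ → (ℕ → Fin n) → Set
IsShortestPath G s t d P = Dist G s t d × IsWalk G s t d P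

data Orientation : Set where
  toRight toLeft : Orientation

-- For a chord a crossing v, the endpoint of a lying on the arc strictly
-- between left v and right v.  Points where chords cross v are ordered
-- along v (from left v to right v) like these endpoints, for pairwise
-- non-crossing chords a, b crossing v.
innerEnd : Chord → Chord → ℕ
innerEnd v a with left v <? left a
... | no _ = right a
... | yes _ with left a <? right v
...   | yes _ = left a
...   | no _  = right a

orient : Chord → Chord → Chord → Orientation
orient v a b = if innerEnd v a <ᵇ innerEnd v b then toRight else toLeft

-- orientation induced on P (suc j) by a path P (predecessor P j,
-- successor P (suc (suc j)))
inducedOrientation : ∀ {n} → ChordRep n → (ℕ → Fin n) → ℕ → Orientation
inducedOrientation G P j =
  orient (chords G (P (suc j))) (chords G (P j)) (chords G (P (suc (suc j))))

-- Let a, b be the predecessor and successor of v on a shortest path P, and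
-- a′, b′ those on another shortest path Q; v has the same distance i + 1 from s
-- on both.  By the distance count, no vertex of P or Q at distance ≤ i from s
-- equals or crosses b′, and none at distance ≥ i + 2 equals or crosses a.
-- Moving along a path through chords disjoint from a chord c never changes
-- which side of c we are on, so a and a′ lie on the same side of b′, and b′
-- and b on the same side of a.  If P and Q induced opposite orientations on v,
-- then, ordering the crossing points along v, either b′ would separate a from
-- a′ or a would separate b′ from b.
module Submission where

open import Defs
open import Data.Nat using (ℕ; zero; suc; _<_; _≤_; _+_; _∸_; _<ᵇ_; _<?_; z≤n; s≤s; z<s; s<s)
open import Data.Nat.Properties
open import Data.Fin using (Fin)
open import Data.Product using (_×_; _,_; proj₁; proj₂)
open import Data.Sum using (inj₁; inj₂)
open import Data.Empty using (⊥; ⊥-elim)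
open import Data.Bool using (true; if_then_else_)
open import Data.Bool.Properties using (T-≡; ⇔→≡)
open import Function using (_∘_; _⇔_; mk⇔; Equivalence)
open import Function.Construct.Identity using (⇔-id)
open import Function.Construct.Symmetry using (⇔-sym)
open import Function.Construct.Composition using (_⇔-∘_)
open import Relation.Nullary using (¬_; yes; no)
open import Relation.Binary using (tri<; tri≈; tri>)
open import Relation.Binary.PropositionalEquality

open Equivalence using (to; from)

Crosses-sym : ∀ {c d} → Crosses c d → Crosses d c
Crosses-sym (inj₁ x) = inj₂ x
Crosses-sym (inj₂ x) = inj₁ x

record DistinctEnds (e f : Chord) : Set where
  field
    ll : left e ≢ left f
    lr : left e ≢ right f
    rl : right e ≢ left f
    rr : right e ≢ right f

record Disjoint (e f : Chord) : Set where
  constructor disjoint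
  field
    noncrossing  : ¬ Crosses e f
    distinctEnds : DistinctEnds e f

record Encloses (e f : Chord) : Set where
  constructor encloses
  field
    left-<  : left e < left f
    right-< : right f < right e

record SameSide (e f g : Chord) : Set where
  constructor sameSide
  field
    disjoint₁ : Disjoint e f
    disjoint₂ : Disjoint e g
    encloses⇔ : Encloses e f ⇔ Encloses e g

data IsEndpoint (p : ℕ) (f : Chord) : Set where
  isLeft  : p ≡ left f  → IsEndpoint p f
  isRight : p ≡ right f → IsEndpoint p f

isEndpoint-within : ∀ {p f} → IsEndpoint p f → left f ≤ p × p ≤ right f
isEndpoint-within {f = f} (isLeft refl) = ≤-refl , <⇒≤ (left<right f)
isEndpoint-within {f = f} (isRight refl) = <⇒≤ (left<right f) , ≤-refl

isEndpoint-distinct : ∀ {e f p q} → DistinctEnds e f → IsEndpoint p e → IsEndpoint q f → p ≢ q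
isEndpoint-distinct D (isLeft refl) (isLeft refl) = DistinctEnds.ll D
isEndpoint-distinct D (isLeft refl) (isRight refl) = DistinctEnds.lr D
isEndpoint-distinct D (isRight refl) (isLeft refl) = DistinctEnds.rl D
isEndpoint-distinct D (isRight refl) (isRight refl) = DistinctEnds.rr D

encloses-if-endpoint-within : ∀ {e f p} → Disjoint e f → IsEndpoint p f →
  left e < p → p < right e → Encloses e f
encloses-if-endpoint-within {e} {f} (disjoint e⋈̸f D) (isLeft refl) e<p p<e with <-cmp (right f) (right e)
... | tri< f<e _ _ = encloses e<p f<e
... | tri≈ _ f≡e _ = ⊥-elim (DistinctEnds.rr D (sym f≡e))
... | tri> _ _ e<f = ⊥-elim (e⋈̸f (inj₁ (e<p , p<e , e<f)))
encloses-if-endpoint-within {e} {f} (disjoint e⋈̸f D) (isRight refl) e<p p<e with <-cmp (left e) (left f)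
... | tri< e<f _ _ = encloses e<f p<e
... | tri≈ _ e≡f _ = ⊥-elim (DistinctEnds.ll D e≡f)
... | tri> _ _ f<e = ⊥-elim (e⋈̸f (inj₂ (f<e , e<p , p<e)))

-- A chord crossing e has an endpoint strictly between the endpoints of e.
encloses-across-crossing : ∀ {c e f} → Disjoint c f → Crosses e f → Encloses c e → Encloses c f
encloses-across-crossing c∥f (inj₁ (le<lf , lf<re , _)) (encloses lc<le re<rc) =
  encloses-if-endpoint-within c∥f (isLeft refl) (<-trans lc<le le<lf) (<-trans lf<re re<rc)
encloses-across-crossing c∥f (inj₂ (_ , le<rf , rf<re)) (encloses lc<le re<rc) =
  encloses-if-endpoint-within c∥f (isRight refl) (<-trans lc<le le<rf) (<-trans rf<re re<rc)

encloses-invariant : ∀ {c e f} → Disjoint c e → Disjoint c f → Crosses e f →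
  Encloses c e ⇔ Encloses c f
encloses-invariant {e = e} {f} c∥e c∥f e⋈f =
  mk⇔ (encloses-across-crossing c∥f e⋈f) (encloses-across-crossing c∥e (Crosses-sym {e} {f} e⋈f))

innerEnd-≡-right : ∀ v e → left e < left v → innerEnd v e ≡ right e
innerEnd-≡-right v e le<lv with left v <? left e
... | no _ = refl
... | yes lv<le = ⊥-elim (<-asym le<lv lv<le)

innerEnd-≡-left : ∀ v e → left v < left e → left e < right v → innerEnd v e ≡ left e
innerEnd-≡-left v e lv<le le<rv with left v <? left e
... | no lv≮le = ⊥-elim (lv≮le lv<le)
... | yes _ with left e <? right v
...   | yes _ = refl
...   | no le≮rv = ⊥-elim (le≮rv le<rv)

innerEnd-isEndpoint : ∀ {v e} → Crosses e v → IsEndpoint (innerEnd v e) e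
innerEnd-isEndpoint {v} {e} (inj₁ (le<lv , _ , _)) = isRight (innerEnd-≡-right v e le<lv)
innerEnd-isEndpoint {v} {e} (inj₂ (lv<le , le<rv , _)) = isLeft (innerEnd-≡-left v e lv<le le<rv)

innerEnd-within : ∀ {v e} → Crosses e v → left v < innerEnd v e × innerEnd v e < right v
innerEnd-within {v} {e} (inj₁ (le<lv , lv<re , re<rv))
  rewrite innerEnd-≡-right v e le<lv = lv<re , re<rv
innerEnd-within {v} {e} (inj₂ (lv<le , le<rv , _))
  rewrite innerEnd-≡-left v e lv<le le<rv = lv<le , le<rv

innerEnd-injective : ∀ {v e f} → Crosses e v → Crosses f v → DistinctEnds e f →
  innerEnd v e ≢ innerEnd v f
innerEnd-injective e⋈v f⋈v D = isEndpoint-distinct D (innerEnd-isEndpoint e⋈v) (innerEnd-isEndpoint f⋈v)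

-- The inner end of e splits the arc of v into the part enclosed by e and the
-- part outside it; a chord crossing v but not e stays within one part.
crossing-chord-separates : ∀ {v e f g} → Crosses e v → Crosses f v → Crosses g v → SameSide e f g →
  innerEnd v f < innerEnd v e → innerEnd v e < innerEnd v g → ⊥
crossing-chord-separates {v} {e} {f} {g} (inj₁ (le<lv , _ , _)) f⋈v g⋈v (sameSide e∥f _ f~g) f<e e<g =
  <-asym e<g (subst (innerEnd v g <_) (sym ie≡re) (≤-<-trans ig≤rg rg<re))
  where
  ie≡re : innerEnd v e ≡ right e
  ie≡re = innerEnd-≡-right v e le<lv
  e⊃f : Encloses e f
  e⊃f = encloses-if-endpoint-within e∥f (innerEnd-isEndpoint f⋈v)
          (<-trans le<lv (proj₁ (innerEnd-within f⋈v))) (subst (innerEnd v f <_) ie≡re f<e)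
  rg<re : right g < right e
  rg<re = Encloses.right-< (to f~g e⊃f)
  ig≤rg : innerEnd v g ≤ right g
  ig≤rg = proj₂ (isEndpoint-within (innerEnd-isEndpoint g⋈v))
crossing-chord-separates {v} {e} {f} {g} (inj₂ (lv<le , le<rv , rv<re)) f⋈v g⋈v (sameSide _ e∥g f~g) f<e e<g =
  <-asym f<e (subst (_< innerEnd v f) (sym ie≡le) (<-≤-trans le<lf lf≤if))
  where
  ie≡le : innerEnd v e ≡ left e
  ie≡le = innerEnd-≡-left v e lv<le le<rv
  e⊃g : Encloses e g
  e⊃g = encloses-if-endpoint-within e∥g (innerEnd-isEndpoint g⋈v)
          (subst (_< innerEnd v g) ie≡le e<g) (<-trans (proj₂ (innerEnd-within g⋈v)) rv<re)
  le<lf : left e < left f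
  le<lf = Encloses.left-< (from f~g e⊃g)
  lf≤if : left f ≤ innerEnd v f
  lf≤if = proj₁ (isEndpoint-within (innerEnd-isEndpoint f⋈v))

orientation-cannot-flip : ∀ {v a b a′ b′} →
  Crosses a v → Crosses b v → Crosses a′ v → Crosses b′ v →
  SameSide b′ a a′ → SameSide a b′ b →
  innerEnd v a < innerEnd v b → innerEnd v b′ < innerEnd v a′ → ⊥
orientation-cannot-flip {v} {a} {b′ = b′} a⋈v b⋈v a′⋈v b′⋈v a~a′ b′~b a<b b′<a′
  with <-cmp (innerEnd v a) (innerEnd v b′)
... | tri< a<b′ _ _ = crossing-chord-separates b′⋈v a⋈v a′⋈v a~a′ a<b′ b′<a′
... | tri≈ _ a≡b′ _ = innerEnd-injective a⋈v b′⋈v (Disjoint.distinctEnds (SameSide.disjoint₁ b′~b)) a≡b′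
... | tri> _ _ b′<a = crossing-chord-separates a⋈v b′⋈v b⋈v b′~b b′<a a<b

<ᵇ-cong : ∀ {m n m′ n′} → (m < n ⇔ m′ < n′) → (m <ᵇ n) ≡ (m′ <ᵇ n′)
<ᵇ-cong {m} {n} {m′} {n′} m<n⇔m′<n′ = ⇔→≡ {z = true} (mk⇔
  (λ eq → to T-≡ (<⇒<ᵇ (to m<n⇔m′<n′ (<ᵇ⇒< m n (from T-≡ eq)))))
  (λ eq → to T-≡ (<⇒<ᵇ (from m<n⇔m′<n′ (<ᵇ⇒< m′ n′ (from T-≡ eq))))))

orient-cong : ∀ {v a b a′ b′} →
  (innerEnd v a < innerEnd v b ⇔ innerEnd v a′ < innerEnd v b′) → orient v a b ≡ orient v a′ b′
orient-cong h = cong (λ x → if x then toRight else toLeft) (<ᵇ-cong h)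

splice : {A : Set} → ℕ → (ℕ → A) → (ℕ → A) → ℕ → A
splice zero    X Y m       = Y m
splice (suc a) X Y zero    = X zero
splice (suc a) X Y (suc m) = splice a (X ∘ suc) Y m

edge : {A : Set} → A → A → ℕ → A
edge u w zero    = u
edge u w (suc _) = w

module _ {n} (G : ChordRep n) where

  private
    ch : Fin n → Chord
    ch = chords G

  Apart : Fin n → Fin n → Set
  Apart u w = u ≢ w × ¬ Adj G u w

  Apart-sym : ∀ {u w} → Apart u w → Apart w u
  Apart-sym {u} {w} (u≢w , u≁w) = u≢w ∘ sym , u≁w ∘ Crosses-sym {ch w} {ch u}

  apart⇒disjoint : ∀ {u w} → Apart u w → Disjoint (ch u) (ch w)
  apart⇒disjoint {u} {w} (u≢w , u≁w) = disjoint u≁w record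
    { ll = proj₁ (distinct G u w u≢w)
    ; lr = proj₁ (proj₂ (distinct G u w u≢w))
    ; rl = proj₁ (proj₂ (distinct G w u (u≢w ∘ sym))) ∘ sym
    ; rr = proj₂ (proj₂ (distinct G u w u≢w))
    }

  walk-prefix : ∀ {s t k j P} → IsWalk G s t k P → j ≤ k → IsWalk G s (P j) j P
  walk-prefix (P0 , _ , adj) j≤k = P0 , refl , λ m m<j → adj m (<-≤-trans m<j j≤k)

  walk-suffix : ∀ {s t k j P} → IsWalk G s t k P → j ≤ k → IsWalk G (P j) t (k ∸ j) (λ m → P (j + m))
  walk-suffix {k = k} {j} {P} (_ , Pk , adj) j≤k =
    cong P (+-identityʳ j) , trans (cong P (m+[n∸m]≡n j≤k)) Pk , adj′
    where
    adj′ : ∀ m → m < k ∸ j → Adj G (P (j + m)) (P (j + suc m))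
    adj′ m m<k∸j = subst (Adj G (P (j + m)) ∘ P) (sym (+-suc j m))
      (adj (j + m) (subst (j + m <_) (m+[n∸m]≡n j≤k) (+-monoʳ-< j m<k∸j)))

  walk-tail : ∀ {s t k P} → IsWalk G s t (suc k) P → IsWalk G (P 1) t k (P ∘ suc)
  walk-tail (_ , Pk , adj) = refl , Pk , λ j j<k → adj (suc j) (s<s j<k)

  walk-++ : ∀ {s u t a b X Y} → IsWalk G s u a X → IsWalk G u t b Y → IsWalk G s t (a + b) (splice a X Y)
  walk-++ {a = zero} (refl , refl , _) wY = wY
  walk-++ {a = suc a} {b} {X} {Y} wX@(X0 , _ , adjX) wY with walk-++ (walk-tail wX) wY
  ... | Z0 , Zend , adjZ = X0 , Zend , adj
    where
    adj : ∀ j → j < suc (a + b) → Adj G (splice (suc a) X Y j) (splice (suc a) X Y (suc j))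
    adj zero    _         = subst (Adj G (X 0)) (sym Z0) (adjX 0 z<s)
    adj (suc j) (s<s j<l) = adjZ j j<l

  walk-edge : ∀ {u w} → Adj G u w → IsWalk G u w 1 (edge u w)
  walk-edge u⋈w = refl , refl , λ { zero _ → u⋈w ; (suc _) (s≤s ()) }

  encloses-along-walk : ∀ {c u w k R} → IsWalk G u w k R → (∀ j → j ≤ k → Apart c (R j)) →
    Encloses (ch c) (ch u) ⇔ Encloses (ch c) (ch w)
  encloses-along-walk {k = zero} (refl , refl , _) _ = ⇔-id _
  encloses-along-walk {k = suc k} W@(_ , refl , adj) apart =
    encloses-invariant (apart⇒disjoint (apart k (n≤1+n k))) (apart⇒disjoint (apart (suc k) ≤-refl))
      (adj k ≤-refl)
    ⇔-∘ encloses-along-walk (walk-prefix W (n≤1+n k)) (λ j j≤k → apart j (m≤n⇒m≤1+n j≤k))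

  sameSide-of-walks-from : ∀ {c u w w′ k k′ R R′} → IsWalk G u w k R → IsWalk G u w′ k′ R′ →
    (∀ j → j ≤ k → Apart c (R j)) → (∀ j → j ≤ k′ → Apart c (R′ j)) →
    SameSide (ch c) (ch w) (ch w′)
  sameSide-of-walks-from W@(_ , refl , _) W′@(_ , refl , _) apart apart′ =
    sameSide (apart⇒disjoint (apart _ ≤-refl)) (apart⇒disjoint (apart′ _ ≤-refl))
      (encloses-along-walk W′ apart′ ⇔-∘ ⇔-sym (encloses-along-walk W apart))

  sameSide-of-walks-to : ∀ {c u w w′ k k′ R R′} → IsWalk G w u k R → IsWalk G w′ u k′ R′ →
    (∀ j → j ≤ k → Apart c (R j)) → (∀ j → j ≤ k′ → Apart c (R′ j)) →
    SameSide (ch c) (ch w) (ch w′)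
  sameSide-of-walks-to W@(refl , _ , _) W′@(refl , _ , _) apart apart′ =
    sameSide (apart⇒disjoint (apart 0 z≤n)) (apart⇒disjoint (apart′ 0 z≤n))
      (⇔-sym (encloses-along-walk W′ apart′) ⇔-∘ encloses-along-walk W apart)

  neighbours-cross : ∀ {s t k i v Z} → IsWalk G s t k Z → suc i < k → Z (suc i) ≡ v →
    Crosses (ch (Z i)) (ch v) × Crosses (ch (Z (suc (suc i)))) (ch v)
  neighbours-cross {i = i} {Z = Z} (_ , _ , adj) i+1<k refl =
    adj i (<-trans (n<1+n i) i+1<k) , Crosses-sym {ch (Z (suc i))} {ch (Z (suc (suc i)))} (adj (suc i) i+1<k)

  module _ {s t : Fin n} {d : ℕ} where

    position-≤-length : ∀ {m a Y W} → IsShortestPath G s t d Y → m ≤ d → IsWalk G s (Y m) a W → m ≤ a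
    position-≤-length {m} {a} ((_ , minimal) , wY) m≤d wW = +-cancelʳ-≤ (d ∸ m) m a (begin
      m + (d ∸ m) ≡⟨ m+[n∸m]≡n m≤d ⟩
      d           ≤⟨ minimal _ _ (walk-++ wW (walk-suffix wY m≤d)) ⟩
      a + (d ∸ m) ∎)
      where open ≤-Reasoning

    position-≤ : ∀ {m m′ X Y} → IsShortestPath G s t d X → IsShortestPath G s t d Y →
      m ≤ d → m′ ≤ d → X m ≡ Y m′ → m′ ≤ m
    position-≤ {m} {X = X} (_ , wX) SY m≤d m′≤d Xm≡Ym′ =
      position-≤-length SY m′≤d (subst (λ u → IsWalk G s u m X) Xm≡Ym′ (walk-prefix wX m≤d))

    position-unique : ∀ {m m′ X Y} → IsShortestPath G s t d X → IsShortestPath G s t d Y →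
      m ≤ d → m′ ≤ d → X m ≡ Y m′ → m ≡ m′
    position-unique SX SY m≤d m′≤d Xm≡Ym′ =
      ≤-antisym (position-≤ SY SX m′≤d m≤d (sym Xm≡Ym′)) (position-≤ SX SY m≤d m′≤d Xm≡Ym′)

    adjacent-position-≤ : ∀ {m m′ X Y} → IsShortestPath G s t d X → IsShortestPath G s t d Y →
      m ≤ d → m′ ≤ d → Adj G (X m) (Y m′) → m′ ≤ suc m
    adjacent-position-≤ {m} {m′} (_ , wX) SY m≤d m′≤d Xm⋈Ym′ = subst (m′ ≤_) (+-comm m 1)
      (position-≤-length SY m′≤d (walk-++ (walk-prefix wX m≤d) (walk-edge Xm⋈Ym′)))

    apart-on-geodesics : ∀ {m m′ X Y} → IsShortestPath G s t d X → IsShortestPath G s t d Y →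
      suc m < m′ → m′ ≤ d → Apart (X m) (Y m′)
    apart-on-geodesics {m} {m′} SX SY m+1<m′ m′≤d =
      (λ eq → <⇒≱ m<m′ (position-≤ SX SY m≤d m′≤d eq)) ,
      (λ adj → <⇒≱ m+1<m′ (adjacent-position-≤ SX SY m≤d m′≤d adj))
      where
      m<m′ : m < m′
      m<m′ = <-trans (n<1+n m) m+1<m′
      m≤d : m ≤ d
      m≤d = <⇒≤ (<-≤-trans m<m′ m′≤d)

    sameSide-before : ∀ {i X Y} → IsShortestPath G s t d X → IsShortestPath G s t d Y →
      suc (suc i) ≤ d → SameSide (ch (Y (suc (suc i)))) (ch (X i)) (ch (Y i))
    sameSide-before {i} {X} {Y} SX SY i+2≤d =
      sameSide-of-walks-from (walk-prefix (proj₂ SX) i≤d) (walk-prefix (proj₂ SY) i≤d)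
        (early SX) (early SY)
      where
      i≤d : i ≤ d
      i≤d = ≤-trans (m≤n+m i 2) i+2≤d
      early : ∀ {Z} → IsShortestPath G s t d Z → ∀ j → j ≤ i → Apart (Y (suc (suc i))) (Z j)
      early SZ j j≤i = Apart-sym (apart-on-geodesics SZ SY (s≤s (s≤s j≤i)) i+2≤d)

    sameSide-after : ∀ {i X Y} → IsShortestPath G s t d X → IsShortestPath G s t d Y →
      suc (suc i) ≤ d → SameSide (ch (X i)) (ch (Y (suc (suc i)))) (ch (X (suc (suc i))))
    sameSide-after {i} {X} {Y} SX SY i+2≤d =
      sameSide-of-walks-to (walk-suffix (proj₂ SY) i+2≤d) (walk-suffix (proj₂ SX) i+2≤d)
        (late SY) (late SX)
      where
      late : ∀ {Z} → IsShortestPath G s t d Z →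
        ∀ j → j ≤ d ∸ suc (suc i) → Apart (X i) (Z (suc (suc i) + j))
      late SZ j j≤ = apart-on-geodesics SX SZ (m≤m+n (suc (suc i)) j)
        (≤-trans (+-monoʳ-≤ (suc (suc i)) j≤) (≤-reflexive (m+[n∸m]≡n i+2≤d)))

    order-preserved : ∀ {i v X Y} → IsShortestPath G s t d X → IsShortestPath G s t d Y →
      suc i < d → X (suc i) ≡ v → Y (suc i) ≡ v →
      innerEnd (ch v) (ch (X i)) < innerEnd (ch v) (ch (X (suc (suc i)))) →
      innerEnd (ch v) (ch (Y i)) < innerEnd (ch v) (ch (Y (suc (suc i))))
    order-preserved {i} {v} {X} {Y} SX SY i+1<d Xv Yv a<b =
      ≤∧≢⇒< (≮⇒≥ (orientation-cannot-flip {ch v} {a} {b} {a′} {b′} a⋈v b⋈v a′⋈v b′⋈v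
                    (sameSide-before SX SY i+1<d) (sameSide-after SX SY i+1<d) a<b))
            (innerEnd-injective a′⋈v b′⋈v
              (Disjoint.distinctEnds (apart⇒disjoint (apart-on-geodesics SY SY ≤-refl i+1<d))))
      where
      a b a′ b′ : Chord
      a  = ch (X i)
      b  = ch (X (suc (suc i)))
      a′ = ch (Y i)
      b′ = ch (Y (suc (suc i)))
      a⋈v : Crosses a (ch v)
      a⋈v = proj₁ (neighbours-cross (proj₂ SX) i+1<d Xv)
      b⋈v : Crosses b (ch v)
      b⋈v = proj₂ (neighbours-cross (proj₂ SX) i+1<d Xv)
      a′⋈v : Crosses a′ (ch v)
      a′⋈v = proj₁ (neighbours-cross (proj₂ SY) i+1<d Yv)
      b′⋈v : Crosses b′ (ch v)
      b′⋈v = proj₂ (neighbours-cross (proj₂ SY) i+1<d Yv)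

    inducedOrientation-agrees : ∀ {i v X Y} → IsShortestPath G s t d X → IsShortestPath G s t d Y →
      suc i < d → X (suc i) ≡ v → Y (suc i) ≡ v → inducedOrientation G X i ≡ inducedOrientation G Y i
    inducedOrientation-agrees {i} {v} {X} {Y} SX SY i+1<d Xv Yv = begin
      orient (ch (X (suc i))) a b   ≡⟨ cong (λ u → orient (ch u) a b) Xv ⟩
      orient (ch v) a b             ≡⟨ orient-cong {ch v} {a} {b} {a′} {b′} a<b⇔a′<b′ ⟩
      orient (ch v) a′ b′           ≡⟨ cong (λ u → orient (ch u) a′ b′) (sym Yv) ⟩
      orient (ch (Y (suc i))) a′ b′ ∎
      where
      open ≡-Reasoning
      a b a′ b′ : Chord
      a  = ch (X i)
      b  = ch (X (suc (suc i)))
      a′ = ch (Y i)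
      b′ = ch (Y (suc (suc i)))
      a<b⇔a′<b′ : innerEnd (ch v) a < innerEnd (ch v) b ⇔ innerEnd (ch v) a′ < innerEnd (ch v) b′
      a<b⇔a′<b′ = mk⇔ (order-preserved SX SY i+1<d Xv Yv) (order-preserved SY SX i+1<d Yv Xv)

mainTheorem14 : ∀ {n} (G : ChordRep n) (s t v : Fin n) (d : ℕ)
    (P Q : ℕ → Fin n) (i j : ℕ) →
    IsShortestPath G s t d P → IsShortestPath G s t d Q →
    suc i < d → suc j < d →
    P (suc i) ≡ v → Q (suc j) ≡ v →
    inducedOrientation G P i ≡ inducedOrientation G Q j
mainTheorem14 G s t v d P Q i j SP SQ i+1<d j+1<d Pv Qv
  with refl ← suc-injective (position-unique G SP SQ (<⇒≤ i+1<d) (<⇒≤ j+1<d) (trans Pv (sym Qv)))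
  = inducedOrientation-agrees G SP SQ i+1<d Pv Qv
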